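{- Let $b,n$ be positive integers with $2n\le b$. For any $(2b+1,b)$-coloring $\varphi$ of the path $P^{4n}$ (vertices $v_0,\ldots,v_{4n}$), there exists a set $X\subseteq\{1,\ldots,2b+1\}$ with $|X|=b+2n$ such that for every $X'\subseteq X$ with $|X'|=n$ there exists a $(2b+1,b)$-coloring $\varphi'$ of $P^{4n}$ with $\varphi'(v_0)=\varphi(v_0)$, $\varphi'(v_{4n})=\varphi(v_{4n})$ and $X'\subseteq\varphi'(v_{2n})$.
   Context: A $(2b+1,b)$-coloring of a graph assigns to each vertex a $b$-subset of $\{1,\ldots,2b+1\}$ so that adjacent vertices receive disjoint sets. $P^m$ is the path with vertices $v_0,\ldots,v_m$ and edges $v_iv_{i+1}$. -}

module Defs where

open import Data.Nat using (ℕ; suc; _*_; _+_)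
open import Data.Fin using (Fin; inject₁) renaming (suc to fsuc)
open import Data.Fin.Subset using (Subset; ∣_∣; _∩_; ⊥)
open import Data.Product using (_×_)
open import Relation.Binary.PropositionalEquality using (_≡_)

-- The path P^m has vertices v_0 , … , v_m, represented by Fin (suc m);
-- edges are v_i v_{i+1}, i.e. (inject₁ i , fsuc i) for i : Fin m.
-- Colours {1,…,2b+1} are represented by Fin (suc (2 * b)) (shift by one).

IsPathColoring : (b m : ℕ) → (Fin (suc m) → Subset (suc (2 * b))) → Set
IsPathColoring b m φ =
  (∀ (v : Fin (suc m)) → ∣ φ v ∣ ≡ b) ×
  (∀ (i : Fin m) → φ (inject₁ i) ∩ φ (fsuc i) ≡ ⊥)

open import Data.Fin using (zero; fromℕ; fromℕ<)
open import Data.Nat using (_≤_; s≤s; z≤n)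
open import Data.Nat.Properties using (≤-trans; m≤m+n; n≤1+n)

vertex : (m i : ℕ) → i ≤ m → Fin (suc m)
vertex m i i≤m = fromℕ< (s≤s i≤m)

2n≤4n : (n : ℕ) → 2 * n ≤ 4 * n
2n≤4n n = ≤-trans (m≤m+n (2 * n) (2 * n)) (Data.Nat.Properties.≤-reflexive (lemma n))
  where
  open import Relation.Binary.PropositionalEquality using (cong)
  open import Data.Nat.Solver using (module +-*-Solver)
  open +-*-Solver
  lemma : (n : ℕ) → 2 * n + 2 * n ≡ 4 * n
  lemma = solve 1 (λ n → con 2 :* n :+ con 2 :* n := con 4 :* n) Relation.Binary.PropositionalEquality.refl

-- Read a (2b+1,b)-coloring of P^m as a walk of length m in the Kneser graph K(2b+1,b).
-- Two b-sets s, t are joined by a walk of length 2k iff ∣ s ∪ t ∣ ≤ b + k: a common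
-- neighbor d gives s ∪ t ⊆ ∁ d, and conversely a detour through ∁ P, with P = s plus one
-- element of t, trades an element of s ─ t for one of t ─ s. Hence the end colors A, B of
-- φ satisfy ∣ A ∪ B ∣ ≤ b + 2n and lie in a set X of size b + 2n. Given X′ ⊆ X of size n,
-- delete from X a 2n-set R avoiding X′ that has n elements outside A and n outside B: the
-- remaining b-set C contains X′ and ∣ A ∪ C ∣, ∣ B ∪ C ∣ ≤ b + n, so walks A → C → B of
-- length 2n each give φ′.

module Submission where

open import Defs
open import Data.Nat using (ℕ; zero; suc; _*_; _+_; _≤_; _<_; _>_; z≤n; s≤s; _≤?_)
open import Data.Nat.Properties
open import Data.Fin using (Fin; zero; suc; toℕ; inject₁)
open import Data.Fin.Properties using (toℕ-fromℕ<)
open import Data.Fin.Subset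
open import Data.Fin.Subset.Properties
open import Data.Vec using ([]; _∷_; here; there)
open import Data.Product using (Σ; _×_; _,_)
open import Data.Sum using ([_,_]′)
open import Relation.Nullary using (yes; no; contradiction)
open import Relation.Binary.PropositionalEquality
open import Data.Nat.Tactic.RingSolver using (solve-∀)

private variable
  n b k L M m : ℕ
  p q r s t u : Subset n

∪-least : p ⊆ r → q ⊆ r → p ∪ q ⊆ r
∪-least {p = p} {q = q} p⊆r q⊆r x∈p∪q = [ p⊆r , q⊆r ]′ (x∈p∪q⁻ p q x∈p∪q)

x∈p─q⇒x∉q : ∀ {x : Fin n} → x ∈ p ─ q → x ∉ q
x∈p─q⇒x∉q {p = inside ∷ p} {outside ∷ q} here ()
x∈p─q⇒x∉q {p = _ ∷ p} {_ ∷ q} (there x∈p─q) (there x∈q) = x∈p─q⇒x∉q x∈p─q x∈q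

⊆∁⇒∩≡⊥ : p ⊆ ∁ q → p ∩ q ≡ ⊥
⊆∁⇒∩≡⊥ {p = p} {q = q} p⊆∁q = Empty-unique λ (x , x∈p∩q) →
  let x∈p , x∈q = x∈p∩q⁻ p q x∈p∩q in x∈∁p⇒x∉p (p⊆∁q x∈p) x∈q

∩≡⊥⇒⊆∁ : p ∩ q ≡ ⊥ → p ⊆ ∁ q
∩≡⊥⇒⊆∁ p∩q≡⊥ x∈p = x∉p⇒x∈∁p λ x∈q → ∉⊥ (subst (_ ∈_) p∩q≡⊥ (x∈p∩q⁺ (x∈p , x∈q)))

⊆⇒∩∁≡⊥ : p ⊆ q → p ∩ ∁ q ≡ ⊥
⊆⇒∩∁≡⊥ p⊆q = ⊆∁⇒∩≡⊥ λ x∈p → x∉p⇒x∈∁p (x∈p⇒x∉∁p (p⊆q x∈p))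

p⊆q∧∣q∣≤∣p∣⇒p≡q : p ⊆ q → ∣ q ∣ ≤ ∣ p ∣ → p ≡ q
p⊆q∧∣q∣≤∣p∣⇒p≡q {p = []} {[]} _ _ = refl
p⊆q∧∣q∣≤∣p∣⇒p≡q {p = inside ∷ p} {inside ∷ q} p⊆q (s≤s ∣q∣≤∣p∣) =
  cong (inside ∷_) (p⊆q∧∣q∣≤∣p∣⇒p≡q (drop-∷-⊆ p⊆q) ∣q∣≤∣p∣)
p⊆q∧∣q∣≤∣p∣⇒p≡q {p = outside ∷ p} {outside ∷ q} p⊆q ∣q∣≤∣p∣ =
  cong (outside ∷_) (p⊆q∧∣q∣≤∣p∣⇒p≡q (drop-∷-⊆ p⊆q) ∣q∣≤∣p∣)
p⊆q∧∣q∣≤∣p∣⇒p≡q {p = outside ∷ p} {inside ∷ q} p⊆q ∣q∣≤∣p∣ =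
  contradiction ∣q∣≤∣p∣ (<⇒≱ (s≤s (p⊆q⇒∣p∣≤∣q∣ (drop-∷-⊆ p⊆q))))
p⊆q∧∣q∣≤∣p∣⇒p≡q {p = inside ∷ p} {outside ∷ q} p⊆q _ = contradiction (p⊆q here) λ ()

∣p─q∣+∣p∩q∣≡∣p∣ : ∀ (p q : Subset n) → ∣ p ─ q ∣ + ∣ p ∩ q ∣ ≡ ∣ p ∣
∣p─q∣+∣p∩q∣≡∣p∣ []            []            = refl
∣p─q∣+∣p∩q∣≡∣p∣ (inside  ∷ p) (inside  ∷ q) = trans (+-suc _ _) (cong suc (∣p─q∣+∣p∩q∣≡∣p∣ p q))
∣p─q∣+∣p∩q∣≡∣p∣ (inside  ∷ p) (outside ∷ q) = cong suc (∣p─q∣+∣p∩q∣≡∣p∣ p q)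
∣p─q∣+∣p∩q∣≡∣p∣ (outside ∷ p) (inside  ∷ q) = ∣p─q∣+∣p∩q∣≡∣p∣ p q
∣p─q∣+∣p∩q∣≡∣p∣ (outside ∷ p) (outside ∷ q) = ∣p─q∣+∣p∩q∣≡∣p∣ p q

∣p∣≤∣p─q∣+∣q∣ : ∀ (p q : Subset n) → ∣ p ∣ ≤ ∣ p ─ q ∣ + ∣ q ∣
∣p∣≤∣p─q∣+∣q∣ p q = subst (_≤ ∣ p ─ q ∣ + ∣ q ∣) (∣p─q∣+∣p∩q∣≡∣p∣ p q)
  (+-monoʳ-≤ ∣ p ─ q ∣ (∣p∩q∣≤∣q∣ p q))

∣p─q∣+∣q∣≡∣p∣ : q ⊆ p → ∣ p ─ q ∣ + ∣ q ∣ ≡ ∣ p ∣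
∣p─q∣+∣q∣≡∣p∣ {q = q} {p = p} q⊆p = begin
  ∣ p ─ q ∣ + ∣ q ∣      ≡⟨ cong (λ r → ∣ p ─ q ∣ + ∣ r ∣) p∩q≡q ⟨
  ∣ p ─ q ∣ + ∣ p ∩ q ∣  ≡⟨ ∣p─q∣+∣p∩q∣≡∣p∣ p q ⟩
  ∣ p ∣                  ∎
  where
  open ≡-Reasoning
  p∩q≡q : p ∩ q ≡ q
  p∩q≡q = ⊆-antisym (p∩q⊆q p q) λ x∈q → x∈p∩q⁺ (q⊆p x∈q , x∈q)

∣p∪q∣+∣p∩q∣≡∣p∣+∣q∣ : ∀ (p q : Subset n) → ∣ p ∪ q ∣ + ∣ p ∩ q ∣ ≡ ∣ p ∣ + ∣ q ∣
∣p∪q∣+∣p∩q∣≡∣p∣+∣q∣ []            []            = refl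
∣p∪q∣+∣p∩q∣≡∣p∣+∣q∣ (inside  ∷ p) (inside  ∷ q) =
  cong suc (trans (+-suc _ _) (trans (cong suc (∣p∪q∣+∣p∩q∣≡∣p∣+∣q∣ p q)) (sym (+-suc _ _))))
∣p∪q∣+∣p∩q∣≡∣p∣+∣q∣ (inside  ∷ p) (outside ∷ q) = cong suc (∣p∪q∣+∣p∩q∣≡∣p∣+∣q∣ p q)
∣p∪q∣+∣p∩q∣≡∣p∣+∣q∣ (outside ∷ p) (inside  ∷ q) =
  trans (cong suc (∣p∪q∣+∣p∩q∣≡∣p∣+∣q∣ p q)) (sym (+-suc _ _))
∣p∪q∣+∣p∩q∣≡∣p∣+∣q∣ (outside ∷ p) (outside ∷ q) = ∣p∪q∣+∣p∩q∣≡∣p∣+∣q∣ p q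

∣p∪q∣≤∣p∣+∣q∣ : ∀ (p q : Subset n) → ∣ p ∪ q ∣ ≤ ∣ p ∣ + ∣ q ∣
∣p∪q∣≤∣p∣+∣q∣ p q = subst (∣ p ∪ q ∣ ≤_) (∣p∪q∣+∣p∩q∣≡∣p∣+∣q∣ p q) (m≤m+n ∣ p ∪ q ∣ ∣ p ∩ q ∣)

∣p∪r∣+∣q∣≤∣p∪q∣+∣q∪r∣ : ∀ (p q r : Subset n) → ∣ p ∪ r ∣ + ∣ q ∣ ≤ ∣ p ∪ q ∣ + ∣ q ∪ r ∣
∣p∪r∣+∣q∣≤∣p∪q∣+∣q∪r∣ p q r = begin
  ∣ p ∪ r ∣ + ∣ q ∣                                ≤⟨ +-mono-≤ (p⊆q⇒∣p∣≤∣q∣ p∪r⊆) (p⊆q⇒∣p∣≤∣q∣ q⊆) ⟩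
  ∣ (p ∪ q) ∪ (q ∪ r) ∣ + ∣ (p ∪ q) ∩ (q ∪ r) ∣  ≡⟨ ∣p∪q∣+∣p∩q∣≡∣p∣+∣q∣ (p ∪ q) (q ∪ r) ⟩
  ∣ p ∪ q ∣ + ∣ q ∪ r ∣                            ∎
  where
  open ≤-Reasoning
  p∪r⊆ : p ∪ r ⊆ (p ∪ q) ∪ (q ∪ r)
  p∪r⊆ = ∪-least (λ x∈p → p⊆p∪q _ (p⊆p∪q q x∈p)) (λ x∈r → q⊆p∪q _ _ (q⊆p∪q q r x∈r))
  q⊆ : q ⊆ (p ∪ q) ∩ (q ∪ r)
  q⊆ x∈q = x∈p∩q⁺ (q⊆p∪q p q x∈q , p⊆p∪q r x∈q)

∣p∣+∣∁p∣≡n : ∀ (p : Subset n) → ∣ p ∣ + ∣ ∁ p ∣ ≡ n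
∣p∣+∣∁p∣≡n p = trans (cong (∣ p ∣ +_) (∣∁p∣≡n∸∣p∣ p)) (m+[n∸m]≡n (∣p∣≤n p))

intermediate-subset : ∀ (p r : Subset n) {m} → p ⊆ r → ∣ p ∣ ≤ m → m ≤ ∣ r ∣ →
  Σ (Subset n) λ q → p ⊆ q × q ⊆ r × ∣ q ∣ ≡ m
intermediate-subset [] [] _ _ z≤n = [] , (λ x∈ → x∈) , (λ x∈ → x∈) , refl
intermediate-subset (inside ∷ p) (inside ∷ r) {suc m} p⊆r (s≤s ∣p∣≤m) (s≤s m≤∣r∣)
  with intermediate-subset p r (drop-∷-⊆ p⊆r) ∣p∣≤m m≤∣r∣
... | q , p⊆q , q⊆r , ∣q∣≡m = inside ∷ q , s⊆s p⊆q , s⊆s q⊆r , cong suc ∣q∣≡m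
intermediate-subset (inside ∷ p) (outside ∷ r) p⊆r _ _ = contradiction (p⊆r here) λ ()
intermediate-subset (outside ∷ p) (outside ∷ r) p⊆r ∣p∣≤m m≤∣r∣
  with intermediate-subset p r (drop-∷-⊆ p⊆r) ∣p∣≤m m≤∣r∣
... | q , p⊆q , q⊆r , ∣q∣≡m = outside ∷ q , out⊆ p⊆q , out⊆ q⊆r , ∣q∣≡m
intermediate-subset (outside ∷ p) (inside ∷ r) {m} p⊆r ∣p∣≤m m≤1+∣r∣ with m ≤? ∣ r ∣
... | no m≰∣r∣ = inside ∷ r , out⊆ (drop-∷-⊆ p⊆r) , (λ x∈ → x∈) , ≤-antisym (≰⇒> m≰∣r∣) m≤1+∣r∣
... | yes m≤∣r∣ with intermediate-subset p r (drop-∷-⊆ p⊆r) ∣p∣≤m m≤∣r∣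
...   | q , p⊆q , q⊆r , ∣q∣≡m = outside ∷ q , out⊆ p⊆q , out⊆ q⊆r , ∣q∣≡m

subset-of-size : ∀ (r : Subset n) {m} → m ≤ ∣ r ∣ → Σ (Subset n) λ q → q ⊆ r × ∣ q ∣ ≡ m
subset-of-size {n} r m≤∣r∣ with intermediate-subset ⊥ r ⊥⊆ (≤-trans (≤-reflexive (∣⊥∣≡0 n)) z≤n) m≤∣r∣
... | q , _ , q⊆r , ∣q∣≡m = q , q⊆r , ∣q∣≡m

exchange : ∣ s ∣ ≡ b → ∣ t ∣ ≡ b → b < ∣ s ∪ t ∣ →
  Σ (Subset n) λ P → Σ (Subset n) λ s′ →
    s ⊆ P × s′ ⊆ P × ∣ P ∣ ≡ suc b × ∣ s′ ∣ ≡ b × ∣ s′ ∪ t ∣ < ∣ s ∪ t ∣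
exchange {s = s} {b = b} {t = t} ∣s∣ ∣t∣ b<∣s∪t∣
  with intermediate-subset s (s ∪ t) (p⊆p∪q t) (≤-trans (≤-reflexive ∣s∣) (n≤1+n b)) b<∣s∪t∣
... | P , s⊆P , P⊆s∪t , ∣P∣
  with intermediate-subset (P ∩ t) P (p∩q⊆p P t) (≤-trans (∣p∩q∣≤∣q∣ P t) (≤-reflexive ∣t∣))
         (≤-trans (n≤1+n b) (≤-reflexive (sym ∣P∣)))
... | s′ , P∩t⊆s′ , s′⊆P , ∣s′∣ = P , s′ , s⊆P , s′⊆P , ∣P∣ , ∣s′∣ , closer
  where
  E : Subset _
  E = P ─ s′
  ∣E∣≡1 : ∣ E ∣ ≡ 1
  ∣E∣≡1 = +-cancelʳ-≡ b _ _ (trans (cong (∣ E ∣ +_) (sym ∣s′∣)) (trans (∣p─q∣+∣q∣≡∣p∣ s′⊆P) ∣P∣))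
  s′∪t⊆[s∪t]─E : s′ ∪ t ⊆ (s ∪ t) ─ E
  s′∪t⊆[s∪t]─E = ∪-least
    (λ x∈s′ → x∈p∧x∉q⇒x∈p─q (P⊆s∪t (s′⊆P x∈s′)) λ x∈E → x∈p─q⇒x∉q x∈E x∈s′)
    (λ x∈t → x∈p∧x∉q⇒x∈p─q (q⊆p∪q s t x∈t) λ x∈E →
      x∈p─q⇒x∉q x∈E (P∩t⊆s′ (x∈p∩q⁺ (p─q⊆p P s′ x∈E , x∈t))))
  closer : ∣ s′ ∪ t ∣ < ∣ s ∪ t ∣
  closer = begin-strict
    ∣ s′ ∪ t ∣               ≤⟨ p⊆q⇒∣p∣≤∣q∣ s′∪t⊆[s∪t]─E ⟩
    ∣ (s ∪ t) ─ E ∣          <⟨ m<m+n _ (≤-reflexive (sym ∣E∣≡1)) ⟩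
    ∣ (s ∪ t) ─ E ∣ + ∣ E ∣  ≡⟨ ∣p─q∣+∣q∣≡∣p∣ (λ x∈E → P⊆s∪t (p─q⊆p P s′ x∈E)) ⟩
    ∣ s ∪ t ∣                ∎
    where open ≤-Reasoning

2*k≡k+k : ∀ k → 2 * k ≡ k + k
2*k≡k+k = solve-∀

b+2*k≡b+k+k : ∀ b k → b + 2 * k ≡ b + k + k
b+2*k≡b+k+k = solve-∀

1+2*b≡b+[1+b] : ∀ b → suc (2 * b) ≡ b + suc b
1+2*b≡b+[1+b] = solve-∀

[1+b]+[b+k]≡b+[1+k]+b : ∀ b k → suc b + (b + k) ≡ b + suc k + b
[1+b]+[b+k]≡b+[1+k]+b = solve-∀

spare-set : ∀ {W A B : Subset n} → k ≤ b → ∣ W ∣ ≡ b + k → ∣ A ∣ ≡ b → ∣ B ∣ ≡ b →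
  Σ (Subset n) λ R → R ⊆ W × ∣ R ∣ ≡ 2 * k × k ≤ ∣ R ─ A ∣ × k ≤ ∣ R ─ B ∣
spare-set {k = k} {b} {W} {A} {B} k≤b ∣W∣ ∣A∣ ∣B∣
  with subset-of-size (W ─ A) (room ∣A∣) | subset-of-size (W ─ B) (room ∣B∣)
  where
  room : ∀ {Y} → ∣ Y ∣ ≡ b → k ≤ ∣ W ─ Y ∣
  room {Y} ∣Y∣ = +-cancelʳ-≤ b k _ (begin
    k + b              ≡⟨ +-comm k b ⟩
    b + k              ≡⟨ ∣W∣ ⟨
    ∣ W ∣              ≤⟨ ∣p∣≤∣p─q∣+∣q∣ W Y ⟩
    ∣ W ─ Y ∣ + ∣ Y ∣  ≡⟨ cong (∣ W ─ Y ∣ +_) ∣Y∣ ⟩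
    ∣ W ─ Y ∣ + b      ∎)
    where open ≤-Reasoning
... | R₁ , R₁⊆W─A , ∣R₁∣ | R₂ , R₂⊆W─B , ∣R₂∣
  with intermediate-subset (R₁ ∪ R₂) W R₁∪R₂⊆W ∣R₁∪R₂∣≤2k 2k≤∣W∣
  where
  R₁∪R₂⊆W : R₁ ∪ R₂ ⊆ W
  R₁∪R₂⊆W = ∪-least (λ x∈R₁ → p─q⊆p W A (R₁⊆W─A x∈R₁)) (λ x∈R₂ → p─q⊆p W B (R₂⊆W─B x∈R₂))
  ∣R₁∪R₂∣≤2k : ∣ R₁ ∪ R₂ ∣ ≤ 2 * k
  ∣R₁∪R₂∣≤2k = begin
    ∣ R₁ ∪ R₂ ∣        ≤⟨ ∣p∪q∣≤∣p∣+∣q∣ R₁ R₂ ⟩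
    ∣ R₁ ∣ + ∣ R₂ ∣    ≡⟨ cong₂ _+_ ∣R₁∣ ∣R₂∣ ⟩
    k + k              ≡⟨ 2*k≡k+k k ⟨
    2 * k              ∎
    where open ≤-Reasoning
  2k≤∣W∣ : 2 * k ≤ ∣ W ∣
  2k≤∣W∣ = begin
    2 * k  ≡⟨ 2*k≡k+k k ⟩
    k + k  ≤⟨ +-monoˡ-≤ k k≤b ⟩
    b + k  ≡⟨ ∣W∣ ⟨
    ∣ W ∣  ∎
    where open ≤-Reasoning
... | R , R₁∪R₂⊆R , R⊆W , ∣R∣ =
  R , R⊆W , ∣R∣ , spare R₁⊆W─A ∣R₁∣ (λ x∈R₁ → R₁∪R₂⊆R (p⊆p∪q R₂ x∈R₁))
                , spare R₂⊆W─B ∣R₂∣ (λ x∈R₂ → R₁∪R₂⊆R (q⊆p∪q R₁ R₂ x∈R₂))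
  where
  spare : ∀ {Y R′} → R′ ⊆ W ─ Y → ∣ R′ ∣ ≡ k → R′ ⊆ R → k ≤ ∣ R ─ Y ∣
  spare R′⊆W─Y ∣R′∣ R′⊆R = ≤-trans (≤-reflexive (sym ∣R′∣)) (p⊆q⇒∣p∣≤∣q∣ λ x∈R′ →
    x∈p∧x∉q⇒x∈p─q (R′⊆R x∈R′) (x∈p─q⇒x∉q (R′⊆W─Y x∈R′)))

middle-color : ∀ {A B X X′ : Subset n} → k ≤ b → ∣ A ∣ ≡ b → ∣ B ∣ ≡ b → A ⊆ X → B ⊆ X →
  ∣ X ∣ ≡ b + 2 * k → X′ ⊆ X → ∣ X′ ∣ ≡ k →
  Σ (Subset n) λ C → ∣ C ∣ ≡ b × X′ ⊆ C × ∣ A ∪ C ∣ ≤ b + k × ∣ B ∪ C ∣ ≤ b + k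
middle-color {k = k} {b} {A} {B} {X} {X′} k≤b ∣A∣ ∣B∣ A⊆X B⊆X ∣X∣ X′⊆X ∣X′∣
  with spare-set k≤b ∣X─X′∣ ∣A∣ ∣B∣
  where
  ∣X─X′∣ : ∣ X ─ X′ ∣ ≡ b + k
  ∣X─X′∣ = +-cancelʳ-≡ k _ _ (begin
    ∣ X ─ X′ ∣ + k       ≡⟨ cong (∣ X ─ X′ ∣ +_) ∣X′∣ ⟨
    ∣ X ─ X′ ∣ + ∣ X′ ∣  ≡⟨ ∣p─q∣+∣q∣≡∣p∣ X′⊆X ⟩
    ∣ X ∣                ≡⟨ ∣X∣ ⟩
    b + 2 * k            ≡⟨ b+2*k≡b+k+k b k ⟩
    b + k + k            ∎)
    where open ≡-Reasoning
... | R , R⊆X─X′ , ∣R∣ , k≤∣R─A∣ , k≤∣R─B∣ =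
  X ─ R , ∣X─R∣ , X′⊆X─R , close A⊆X k≤∣R─A∣ , close B⊆X k≤∣R─B∣
  where
  R⊆X : R ⊆ X
  R⊆X x∈R = p─q⊆p X X′ (R⊆X─X′ x∈R)
  ∣X─R∣ : ∣ X ─ R ∣ ≡ b
  ∣X─R∣ = +-cancelʳ-≡ (2 * k) _ _
    (trans (cong (∣ X ─ R ∣ +_) (sym ∣R∣)) (trans (∣p─q∣+∣q∣≡∣p∣ R⊆X) ∣X∣))
  X′⊆X─R : X′ ⊆ X ─ R
  X′⊆X─R x∈X′ = x∈p∧x∉q⇒x∈p─q (X′⊆X x∈X′) λ x∈R → x∈p─q⇒x∉q (R⊆X─X′ x∈R) x∈X′
  close : ∀ {Y} → Y ⊆ X → k ≤ ∣ R ─ Y ∣ → ∣ Y ∪ (X ─ R) ∣ ≤ b + k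
  close {Y} Y⊆X k≤∣R─Y∣ = +-cancelʳ-≤ k _ _ (begin
    ∣ Y ∪ (X ─ R) ∣ + k              ≤⟨ +-mono-≤ (p⊆q⇒∣p∣≤∣q∣ Y∪[X─R]⊆X─[R─Y]) k≤∣R─Y∣ ⟩
    ∣ X ─ (R ─ Y) ∣ + ∣ R ─ Y ∣      ≡⟨ ∣p─q∣+∣q∣≡∣p∣ (λ x∈R─Y → R⊆X (p─q⊆p R Y x∈R─Y)) ⟩
    ∣ X ∣                            ≡⟨ ∣X∣ ⟩
    b + 2 * k                        ≡⟨ b+2*k≡b+k+k b k ⟩
    b + k + k                        ∎)
    where
    open ≤-Reasoning
    Y∪[X─R]⊆X─[R─Y] : Y ∪ (X ─ R) ⊆ X ─ (R ─ Y)
    Y∪[X─R]⊆X─[R─Y] = ∪-least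
      (λ x∈Y → x∈p∧x∉q⇒x∈p─q (Y⊆X x∈Y) λ x∈R─Y → x∈p─q⇒x∉q x∈R─Y x∈Y)
      (λ x∈X─R → x∈p∧x∉q⇒x∈p─q (p─q⊆p X R x∈X─R) λ x∈R─Y → x∈p─q⇒x∉q x∈X─R (p─q⊆p R Y x∈R─Y))

module KneserWalks (b : ℕ) where

  data Walk : Subset (suc (2 * b)) → Subset (suc (2 * b)) → ℕ → Set where
    stop : ∣ s ∣ ≡ b → Walk s s 0
    step : ∣ s ∣ ≡ b → s ∩ t ≡ ⊥ → Walk t u L → Walk s u (suc L)

  head-size : Walk s t L → ∣ s ∣ ≡ b
  head-size (stop ∣s∣)     = ∣s∣
  head-size (step ∣s∣ _ _) = ∣s∣

  last-size : Walk s t L → ∣ t ∣ ≡ b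
  last-size (stop ∣s∣)   = ∣s∣
  last-size (step _ _ w) = last-size w

  _++_ : Walk s t L → Walk t u M → Walk s u (L + M)
  stop _         ++ w′ = w′
  step ∣s∣ s∩t w ++ w′ = step ∣s∣ s∩t (w ++ w′)

  colors : Walk s t L → Fin (suc L) → Subset (suc (2 * b))
  colors {s = s} _ zero    = s
  colors (step _ _ w) (suc i) = colors w i

  colors-isPathColoring : (w : Walk s t L) → IsPathColoring b L (colors w)
  colors-isPathColoring w = sizes w , edges w
    where
    sizes : (w : Walk s t L) → ∀ v → ∣ colors w v ∣ ≡ b
    sizes w            zero    = head-size w
    sizes (step _ _ w) (suc v) = sizes w v
    edges : (w : Walk s t L) → ∀ i → colors w (inject₁ i) ∩ colors w (suc i) ≡ ⊥
    edges (step _ s∩t _) zero    = s∩t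
    edges (step _ _ w)   (suc i) = edges w i

  colors-last : (w : Walk s t L) {i : Fin (suc L)} → toℕ i ≡ L → colors w i ≡ t
  colors-last (stop _)     {zero}  _ = refl
  colors-last (step _ _ w) {suc i} i≡L = colors-last w (suc-injective i≡L)

  colors-++ : (w : Walk s t L) (w′ : Walk t u M) {i : Fin (suc (L + M))} →
    toℕ i ≡ L → colors (w ++ w′) i ≡ t
  colors-++ (stop _)     w′ {zero}  _   = refl
  colors-++ (step _ _ w) w′ {suc i} i≡L = colors-++ w w′ (suc-injective i≡L)

  walk-of-coloring : ∀ m (φ : Fin (suc m) → Subset (suc (2 * b))) → IsPathColoring b m φ →
    Walk (φ zero) (φ (vertex m m ≤-refl)) m
  walk-of-coloring zero    φ (size , _)    = stop (size zero)
  walk-of-coloring (suc m) φ (size , edge) =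
    step (size zero) (edge zero)
      (walk-of-coloring m (λ v → φ (suc v)) ((λ v → size (suc v)) , λ i → edge (suc i)))

  coloring-through : L + M ≡ m → Walk s t L → Walk t u M →
    Σ (Fin (suc m) → Subset (suc (2 * b))) λ φ → IsPathColoring b m φ × φ zero ≡ s ×
      (∀ i → toℕ i ≡ m → φ i ≡ u) × (∀ i → toℕ i ≡ L → φ i ≡ t)
  coloring-through refl w w′ =
    colors (w ++ w′) , colors-isPathColoring (w ++ w′) , refl ,
    (λ _ → colors-last (w ++ w′)) , λ _ → colors-++ w w′

  ∣∁p∣≡1+b : (p : Subset (suc (2 * b))) → ∣ p ∣ ≡ b → ∣ ∁ p ∣ ≡ suc b
  ∣∁p∣≡1+b p ∣p∣ = +-cancelˡ-≡ b _ _
    (trans (cong (_+ ∣ ∁ p ∣) (sym ∣p∣)) (trans (∣p∣+∣∁p∣≡n p) (1+2*b≡b+[1+b] b)))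

  ∣∁p∣≡b : (p : Subset (suc (2 * b))) → ∣ p ∣ ≡ suc b → ∣ ∁ p ∣ ≡ b
  ∣∁p∣≡b p ∣p∣ = +-cancelˡ-≡ (suc b) _ _
    (trans (cong (_+ ∣ ∁ p ∣) (sym ∣p∣)) (trans (∣p∣+∣∁p∣≡n p) (trans (1+2*b≡b+[1+b] b) (+-comm b (suc b)))))

  ∣s∪u∣≤1+b : {s t u : Subset (suc (2 * b))} → ∣ t ∣ ≡ b → s ∩ t ≡ ⊥ → t ∩ u ≡ ⊥ → ∣ s ∪ u ∣ ≤ suc b
  ∣s∪u∣≤1+b {s} {t} {u} ∣t∣ s∩t t∩u = begin
    ∣ s ∪ u ∣  ≤⟨ p⊆q⇒∣p∣≤∣q∣ (∪-least (∩≡⊥⇒⊆∁ s∩t) (∩≡⊥⇒⊆∁ (trans (∩-comm u t) t∩u))) ⟩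
    ∣ ∁ t ∣    ≡⟨ ∣∁p∣≡1+b t ∣t∣ ⟩
    suc b      ∎
    where open ≤-Reasoning

  even-walk⇒∣∪∣≤ : ∀ k → Walk s u (2 * k) → ∣ s ∪ u ∣ ≤ b + k
  even-walk⇒∣∪∣≤ {s = s} zero (stop ∣s∣) =
    ≤-reflexive (trans (cong ∣_∣ (∪-idem s)) (trans ∣s∣ (sym (+-identityʳ b))))
  even-walk⇒∣∪∣≤ {s = s} {u = u} (suc k) w with subst (Walk s u) (*-suc 2 k) w
  ... | step ∣s∣ s∩d (step {t = t} ∣d∣ d∩t w′) = +-cancelʳ-≤ b _ _ (begin
    ∣ s ∪ u ∣ + b          ≡⟨ cong (∣ s ∪ u ∣ +_) (head-size w′) ⟨
    ∣ s ∪ u ∣ + ∣ t ∣      ≤⟨ ∣p∪r∣+∣q∣≤∣p∪q∣+∣q∪r∣ s t u ⟩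
    ∣ s ∪ t ∣ + ∣ t ∪ u ∣  ≤⟨ +-mono-≤ (∣s∪u∣≤1+b ∣d∣ s∩d d∩t) (even-walk⇒∣∪∣≤ k w′) ⟩
    suc b + (b + k)        ≡⟨ [1+b]+[b+k]≡b+[1+k]+b b k ⟩
    b + suc k + b          ∎)
    where open ≤-Reasoning

  detour : Walk s t L → Walk s t (2 + L)
  detour {s = s} w with subset-of-size (∁ s) (≤-trans (n≤1+n b) (≤-reflexive (sym (∣∁p∣≡1+b s (head-size w)))))
  ... | d , d⊆∁s , ∣d∣ = step (head-size w) (trans (∩-comm s d) d∩s) (step ∣d∣ d∩s w)
    where
    d∩s : d ∩ s ≡ ⊥
    d∩s = ⊆∁⇒∩≡⊥ d⊆∁s

  ∣∪∣≤⇒even-walk : ∀ k → ∣ s ∣ ≡ b → ∣ t ∣ ≡ b → ∣ s ∪ t ∣ ≤ b + k → Walk s t (2 * k)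
  ∣∪∣≤⇒even-walk {s = s} {t = t} zero ∣s∣ ∣t∣ ∣s∪t∣≤b+0 = subst (λ t → Walk s t 0) s≡t (stop ∣s∣)
    where
    ∣s∪t∣≤ : ∀ r → ∣ r ∣ ≡ b → ∣ s ∪ t ∣ ≤ ∣ r ∣
    ∣s∪t∣≤ _ ∣r∣ = ≤-trans ∣s∪t∣≤b+0 (≤-reflexive (trans (+-identityʳ b) (sym ∣r∣)))
    s≡t : s ≡ t
    s≡t = trans (p⊆q∧∣q∣≤∣p∣⇒p≡q (p⊆p∪q t) (∣s∪t∣≤ s ∣s∣))
                (sym (p⊆q∧∣q∣≤∣p∣⇒p≡q (q⊆p∪q s t) (∣s∪t∣≤ t ∣t∣)))
  ∣∪∣≤⇒even-walk {s = s} {t = t} (suc k) ∣s∣ ∣t∣ ∣s∪t∣≤ with ∣ s ∪ t ∣ ≤? b + k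
  ... | yes ∣s∪t∣≤b+k =
    subst (Walk s t) (sym (*-suc 2 k)) (detour (∣∪∣≤⇒even-walk k ∣s∣ ∣t∣ ∣s∪t∣≤b+k))
  ... | no ∣s∪t∣≰b+k with exchange ∣s∣ ∣t∣ (≤-<-trans (m≤m+n b k) (≰⇒> ∣s∪t∣≰b+k))
  ...   | P , s′ , s⊆P , s′⊆P , ∣P∣ , ∣s′∣ , closer =
    subst (Walk s t) (sym (*-suc 2 k))
      (step ∣s∣ (⊆⇒∩∁≡⊥ s⊆P)
        (step (∣∁p∣≡b P ∣P∣) (trans (∩-comm (∁ P) s′) (⊆⇒∩∁≡⊥ s′⊆P))
          (∣∪∣≤⇒even-walk k ∣s′∣ ∣t∣ ∣s′∪t∣≤b+k)))
    where
    ∣s′∪t∣≤b+k : ∣ s′ ∪ t ∣ ≤ b + k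
    ∣s′∪t∣≤b+k = ≤-pred (≤-trans closer (≤-trans ∣s∪t∣≤ (≤-reflexive (+-suc b k))))

  flexible-middle : ∀ k {A B} → 2 * k ≤ b → Walk A B (4 * k) →
    Σ (Subset (suc (2 * b))) λ X → ∣ X ∣ ≡ b + 2 * k ×
      (∀ {X′} → X′ ⊆ X → ∣ X′ ∣ ≡ k →
        Σ (Subset (suc (2 * b))) λ C → Walk A C (2 * k) × Walk C B (2 * k) × X′ ⊆ C)
  flexible-middle k {A} {B} 2k≤b w
    with intermediate-subset (A ∪ B) ⊤ ⊆⊤ ∣A∪B∣≤b+2k b+2k≤∣⊤∣
    where
    ∣A∪B∣≤b+2k : ∣ A ∪ B ∣ ≤ b + 2 * k
    ∣A∪B∣≤b+2k = even-walk⇒∣∪∣≤ (2 * k) (subst (Walk A B) (*-assoc 2 2 k) w)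
    b+2k≤∣⊤∣ : b + 2 * k ≤ ∣ ⊤ {suc (2 * b)} ∣
    b+2k≤∣⊤∣ = begin
      b + 2 * k    ≤⟨ +-monoʳ-≤ b 2k≤b ⟩
      b + b        ≤⟨ +-monoʳ-≤ b (n≤1+n b) ⟩
      b + suc b    ≡⟨ 1+2*b≡b+[1+b] b ⟨
      suc (2 * b)  ≡⟨ ∣⊤∣≡n (suc (2 * b)) ⟨
      ∣ ⊤ {suc (2 * b)} ∣ ∎
      where open ≤-Reasoning
  ... | X , A∪B⊆X , _ , ∣X∣ = X , ∣X∣ , middle
    where
    middle : ∀ {X′} → X′ ⊆ X → ∣ X′ ∣ ≡ k →
      Σ (Subset (suc (2 * b))) λ C → Walk A C (2 * k) × Walk C B (2 * k) × X′ ⊆ C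
    middle X′⊆X ∣X′∣ =
      let C , ∣C∣ , X′⊆C , ∣A∪C∣≤b+k , ∣B∪C∣≤b+k =
            middle-color (≤-trans (m≤m+n k (k + 0)) 2k≤b) (head-size w) (last-size w)
              (λ x∈A → A∪B⊆X (p⊆p∪q B x∈A)) (λ x∈B → A∪B⊆X (q⊆p∪q A B x∈B)) ∣X∣ X′⊆X ∣X′∣
      in C , ∣∪∣≤⇒even-walk k (head-size w) ∣C∣ ∣A∪C∣≤b+k ,
         ∣∪∣≤⇒even-walk k ∣C∣ (last-size w) (subst (λ Z → ∣ Z ∣ ≤ b + k) (∪-comm B C) ∣B∪C∣≤b+k) ,
         X′⊆C

toℕ-vertex : ∀ m j (j≤m : j ≤ m) → toℕ (vertex m j j≤m) ≡ j
toℕ-vertex m j j≤m = toℕ-fromℕ< (s≤s j≤m)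

lemma6 : (b n : ℕ) → b > 0 → n > 0 → 2 * n ≤ b →
    (φ : Fin (suc (4 * n)) → Subset (suc (2 * b))) → IsPathColoring b (4 * n) φ →
    Σ (Subset (suc (2 * b))) λ X → (∣ X ∣ ≡ b + 2 * n) ×
      ((X′ : Subset (suc (2 * b))) → X′ ⊆ X → ∣ X′ ∣ ≡ n →
        Σ (Fin (suc (4 * n)) → Subset (suc (2 * b))) λ φ′ →
          IsPathColoring b (4 * n) φ′ ×
          (φ′ (vertex (4 * n) 0 z≤n) ≡ φ (vertex (4 * n) 0 z≤n)) ×
          (φ′ (vertex (4 * n) (4 * n) ≤-refl) ≡ φ (vertex (4 * n) (4 * n) ≤-refl)) ×
          (X′ ⊆ φ′ (vertex (4 * n) (2 * n) (2n≤4n n))))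
lemma6 b n _ _ 2n≤b φ φ-coloring =
  let X , ∣X∣ , middle = flexible-middle n 2n≤b (walk-of-coloring (4 * n) φ φ-coloring)
  in X , ∣X∣ , λ X′ X′⊆X ∣X′∣ →
    let C , w₁ , w₂ , X′⊆C = middle X′⊆X ∣X′∣
        φ′ , φ′-coloring , φ′-first , φ′-last , φ′-middle =
          coloring-through (sym (*-distribʳ-+ n 2 2)) w₁ w₂
    in φ′ , φ′-coloring , φ′-first ,
       φ′-last _ (toℕ-vertex (4 * n) (4 * n) ≤-refl) ,
       λ x∈X′ → subst (_ ∈_) (sym (φ′-middle _ (toℕ-vertex (4 * n) (2 * n) (2n≤4n n)))) (X′⊆C x∈X′)
  where open KneserWalks b
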